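{- Suppose $Act=\{a\}$. Then the axiom system $\mathcal{E}_{\omega,1}'=\{A1,A2,A3,A4,V1_\omega,O1\}$, where (A1) $x+y=y+x$, (A2) $x+(y+z)=(x+y)+z$, (A3) $x+x=x$, (A4) $x+\mathit{end}=x$, $(V1_\omega)$ $x=a.x$, and $(O1)$ $\mathit{yes}+\mathit{no}=\mathit{yes}+\mathit{no}+x$, is complete for $\omega$-verdict equivalence over open monitors: for all $m,n\in Mon_F$, if $m\simeq_\omega n$ then $\mathcal{E}_{\omega,1}'\vdash m=n$.
   Context: Let $Act$ be a set of visible actions, $\tau\notin Act$, and $Var$ a countably infinite set of variables disjoint from $Act\cup\{\tau\}$. Monitors $Mon_F$: $m,n ::= v \mid b.m \mid m+n \mid x$ ($b\in Act$, $x\in Var$), verdicts $v ::= \mathit{end}\mid \mathit{yes}\mid \mathit{no}$. Closed monitors contain no variables; (closed) substitutions map variables to (closed) monitors. Transitions: for $\alpha\in Act\cup\{\tau\}$, $\xrightarrow{\alpha}$ is the least relation with $b.m\xrightarrow{b}m$; if $m\xrightarrow{\alpha}m'$ then $m+n\xrightarrow{\alpha}m'$ and $n+m\xrightarrow{\alpha}m'$; and $v\xrightarrow{\alpha}v$ for every verdict $v$ and every $\alpha$. Weak transitions: $m\xRightarrow{\varepsilon}m'$ iff $m(\xrightarrow{\tau})^*m'$; $m\xRightarrow{b}m'$ iff $m\xRightarrow{\varepsilon}m_1\xrightarrow{b}m_2\xRightarrow{\varepsilon}m'$; $m\xRightarrow{bs'}m'$ ($s'\neq\varepsilon$) iff $m\xRightarrow{b}m_1\xRightarrow{s'}m'$.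 $L_a(m)=\{s\in Act^*\mid m\xRightarrow{s}\mathit{yes}\}$, $L_r(m)=\{s\in Act^*\mid m\xRightarrow{s}\mathit{no}\}$. Closed $m\simeq_\omega n$ iff $L_a(m)\cdot Act^\omega=L_a(n)\cdot Act^\omega$ and $L_r(m)\cdot Act^\omega=L_r(n)\cdot Act^\omega$; open $m\simeq_\omega n$ iff $\sigma(m)\simeq_\omega\sigma(n)$ for all closed substitutions $\sigma$. $\mathcal{E}\vdash m=n$: derivability by reflexivity, symmetry, transitivity, substitutivity and congruence for prefixing and $+$. -}

module Defs where

open import Data.Nat using (ℕ)
open import Data.List using (List; []; _∷_)
open import Data.Maybe using (Maybe; just; nothing)
open import Data.Product using (Σ; _×_; _,_)
open import Data.Unit using (⊤; tt)
open import Relation.Binary.PropositionalEquality using (_≡_)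
open import Function.Bundles using (_⇔_)

Var : Set
Var = ℕ

data Verdict : Set where
  end yes no : Verdict

data Mon (Act : Set) : Set where
  verd : Verdict → Mon Act
  _∙_  : Act → Mon Act → Mon Act
  _⊕_  : Mon Act → Mon Act → Mon Act
  var  : Var → Mon Act

infixr 7 _∙_
infixl 6 _⊕_

module _ {Act : Set} where

  data Closed : Mon Act → Set where
    verd : ∀ v → Closed (verd v)
    pre  : ∀ b {m} → Closed m → Closed (b ∙ m)
    sum  : ∀ {m n} → Closed m → Closed n → Closed (m ⊕ n)

  Subst : Set
  Subst = Var → Mon Act

  _[_] : Mon Act → Subst → Mon Act
  verd v [ σ ] = verd v
  (b ∙ m) [ σ ] = b ∙ (m [ σ ])
  (m ⊕ n) [ σ ] = (m [ σ ]) ⊕ (n [ σ ])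
  var x [ σ ] = σ x

  ClosedSubst : Subst → Set
  ClosedSubst σ = ∀ x → Closed (σ x)

  -- Labels: just b is visible action b, nothing is τ.
  Label : Set
  Label = Maybe Act

  data _─[_]→_ : Mon Act → Label → Mon Act → Set where
    pre   : ∀ b m → (b ∙ m) ─[ just b ]→ m
    sumˡ  : ∀ {m m' α} n → m ─[ α ]→ m' → (m ⊕ n) ─[ α ]→ m'
    sumʳ  : ∀ {m m' α} n → m ─[ α ]→ m' → (n ⊕ m) ─[ α ]→ m'
    verd  : ∀ v α → verd v ─[ α ]→ verd v

  data _⇒ε_ : Mon Act → Mon Act → Set where
    ε-refl : ∀ {m} → m ⇒ε m
    ε-step : ∀ {m m₁ m'} → m ─[ nothing ]→ m₁ → m₁ ⇒ε m' → m ⇒ε m'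

  _⇒₁[_]_ : Mon Act → Act → Mon Act → Set
  m ⇒₁[ b ] m' = Σ (Mon Act) λ m₁ → Σ (Mon Act) λ m₂ →
                   (m ⇒ε m₁) × (m₁ ─[ just b ]→ m₂) × (m₂ ⇒ε m')

  _⇒[_]_ : Mon Act → List Act → Mon Act → Set
  m ⇒[ [] ] m' = m ⇒ε m'
  m ⇒[ b ∷ [] ] m' = m ⇒₁[ b ] m'
  m ⇒[ b ∷ s@(_ ∷ _) ] m' = Σ (Mon Act) λ m₁ → (m ⇒₁[ b ] m₁) × (m₁ ⇒[ s ] m')

  Lₐ : Mon Act → List Act → Set
  Lₐ m s = m ⇒[ s ] verd yes

  Lᵣ : Mon Act → List Act → Set
  Lᵣ m s = m ⇒[ s ] verd no

  InfWord : Set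
  InfWord = ℕ → Act

  data _≼_ : List Act → InfWord → Set where
    []≼ : ∀ {w} → [] ≼ w
    ∷≼  : ∀ {b s w} → w 0 ≡ b → s ≼ (λ i → w (ℕ.suc i)) → (b ∷ s) ≼ w

  _∈·ω_ : InfWord → (List Act → Set) → Set
  w ∈·ω L = Σ (List Act) λ s → L s × (s ≼ w)

  _≃ωᶜ_ : Mon Act → Mon Act → Set
  m ≃ωᶜ n = (∀ w → (w ∈·ω Lₐ m) ⇔ (w ∈·ω Lₐ n))
          × (∀ w → (w ∈·ω Lᵣ m) ⇔ (w ∈·ω Lᵣ n))

  _≃ω_ : Mon Act → Mon Act → Set
  m ≃ω n = ∀ σ → ClosedSubst σ → (m [ σ ]) ≃ωᶜ (n [ σ ])

  data _⊢_≈_ (E : Mon Act → Mon Act → Set) : Mon Act → Mon Act → Set where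
    ax    : ∀ {t u} → E t u → (σ : Subst) → E ⊢ (t [ σ ]) ≈ (u [ σ ])
    refl  : ∀ {m} → E ⊢ m ≈ m
    sym   : ∀ {m n} → E ⊢ m ≈ n → E ⊢ n ≈ m
    trans : ∀ {m n o} → E ⊢ m ≈ n → E ⊢ n ≈ o → E ⊢ m ≈ o
    pre   : ∀ b {m n} → E ⊢ m ≈ n → E ⊢ (b ∙ m) ≈ (b ∙ n)
    sum   : ∀ {m m' n n'} → E ⊢ m ≈ m' → E ⊢ n ≈ n' → E ⊢ (m ⊕ n) ≈ (m' ⊕ n')

ActA : Set
ActA = ⊤

a : ActA
a = tt

x y z : Mon ActA
x = var 0
y = var 1
z = var 2

data E'ω1 : Mon ActA → Mon ActA → Set where
  A1  : E'ω1 (x ⊕ y) (y ⊕ x)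
  A2  : E'ω1 (x ⊕ (y ⊕ z)) ((x ⊕ y) ⊕ z)
  A3  : E'ω1 (x ⊕ x) x
  A4  : E'ω1 (x ⊕ verd end) x
  V1ω : E'ω1 x (a ∙ x)
  O1  : E'ω1 (verd yes ⊕ verd no) ((verd yes ⊕ verd no) ⊕ x)

-- Over the one-letter alphabet every finite trace is a prefix of aω, so m ≃ω n says
-- exactly that, for every closed σ, m[σ] and n[σ] contain the same conclusive verdicts
-- (yes and no). Instantiating every variable by end, or a single variable x by a
-- conclusive verdict that m lacks, shows that unless m contains both yes and no, every
-- atom (yes, no or a variable) of n occurs in m. Up to V1ω, which erases prefixes, and
-- A4, which erases end, a monitor is the sum of its atoms, so then m + n = m by A1–A3;
-- and a monitor containing yes and no swallows anything by O1.
-- Hence m = m + n = n + m = n.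
module Submission where

open import Defs
open import Data.Nat using (suc) renaming (_≟_ to _≟ℕ_)
open import Data.List using (List; []; _∷_)
open import Data.Maybe using (nothing)
open import Data.Product using (Σ; _×_; _,_; proj₁; map₁; map₂)
import Data.Product as Product
open import Data.Sum using (_⊎_; inj₁; inj₂; [_,_]′)
import Data.Sum as Sum
open import Data.Empty using (⊥-elim)
open import Function using (_∘_)
open import Function.Bundles using (Equivalence)
import Function.Properties.Equivalence as ⇔
open import Relation.Nullary using (Dec; ¬_)
import Relation.Nullary as Dec
open import Relation.Nullary.Decidable using (map′; _⊎-dec_)
open import Relation.Binary.Bundles using (Setoid)
open import Relation.Binary.Definitions using (DecidableEquality)
open import Relation.Binary.PropositionalEquality using (_≡_; refl)
import Relation.Binary.Reasoning.Setoid as SetoidReasoning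

M : Set
M = Mon ActA

infix 4 _≈_ _⊑_ _⊆ᵃ_

_≈_ : M → M → Set
m ≈ n = E'ω1 ⊢ m ≈ n

≈-setoid : Setoid _ _
≈-setoid = record
  { Carrier = M
  ; _≈_ = _≈_
  ; isEquivalence = record { refl = refl ; sym = sym ; trans = trans }
  }

open SetoidReasoning ≈-setoid

⟨_,_,_⟩ : M → M → M → Subst {ActA}
⟨ m , n , o ⟩ 0 = m
⟨ m , n , o ⟩ 1 = n
⟨ m , n , o ⟩ _ = o

⊕-comm : ∀ m n → m ⊕ n ≈ n ⊕ m
⊕-comm m n = ax A1 ⟨ m , n , n ⟩

⊕-assoc : ∀ m n o → m ⊕ (n ⊕ o) ≈ (m ⊕ n) ⊕ o
⊕-assoc m n o = ax A2 ⟨ m , n , o ⟩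

⊕-idem : ∀ m → m ⊕ m ≈ m
⊕-idem m = ax A3 λ _ → m

⊕-identityʳ : ∀ m → m ⊕ verd end ≈ m
⊕-identityʳ m = ax A4 λ _ → m

∙-erase : ∀ b m → b ∙ m ≈ m
∙-erase _ m = sym (ax V1ω λ _ → m)

yes⊕no-zeroˡ : ∀ m → (verd yes ⊕ verd no) ⊕ m ≈ verd yes ⊕ verd no
yes⊕no-zeroˡ m = sym (ax O1 λ _ → m)

data _⊑_ (t : M) : M → Set where
  here  : t ⊑ t
  pre   : ∀ b {m} → t ⊑ m → t ⊑ b ∙ m
  left  : ∀ {m n} → t ⊑ m → t ⊑ m ⊕ n
  right : ∀ {m n} → t ⊑ n → t ⊑ m ⊕ n

⊑-trans : ∀ {t m n} → t ⊑ m → m ⊑ n → t ⊑ n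
⊑-trans t⊑m here = t⊑m
⊑-trans t⊑m (pre b m⊑n) = pre b (⊑-trans t⊑m m⊑n)
⊑-trans t⊑m (left m⊑n) = left (⊑-trans t⊑m m⊑n)
⊑-trans t⊑m (right m⊑n) = right (⊑-trans t⊑m m⊑n)

⊑-verd : ∀ {u v} → verd u ⊑ verd v → u ≡ v
⊑-verd here = refl

_≟ᵛ_ : DecidableEquality Verdict
end ≟ᵛ end = Dec.yes refl
yes ≟ᵛ yes = Dec.yes refl
no  ≟ᵛ no  = Dec.yes refl
end ≟ᵛ yes = Dec.no λ ()
end ≟ᵛ no  = Dec.no λ ()
yes ≟ᵛ end = Dec.no λ ()
yes ≟ᵛ no  = Dec.no λ ()
no  ≟ᵛ end = Dec.no λ ()
no  ≟ᵛ yes = Dec.no λ ()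

verd-⊑? : ∀ v m → Dec (verd v ⊑ m)
verd-⊑? v (verd w) = map′ (λ { refl → here }) ⊑-verd (v ≟ᵛ w)
verd-⊑? v (b ∙ m) = map′ (pre b) (λ { (pre _ p) → p }) (verd-⊑? v m)
verd-⊑? v (m ⊕ n) =
  map′ [ left , right ]′ (λ { (left p) → inj₁ p ; (right p) → inj₂ p })
       (verd-⊑? v m ⊎-dec verd-⊑? v n)
verd-⊑? v (var x) = Dec.no λ ()

⊕-absorbs-⊑ : ∀ {t m} → t ⊑ m → m ⊕ t ≈ m
⊕-absorbs-⊑ {t} here = ⊕-idem t
⊕-absorbs-⊑ {t} (pre b {m} t⊑m) = begin
  b ∙ m ⊕ t  ≈⟨ sum (∙-erase b m) refl ⟩
  m ⊕ t      ≈⟨ ⊕-absorbs-⊑ t⊑m ⟩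
  m          ≈⟨ ∙-erase b m ⟨
  b ∙ m      ∎
⊕-absorbs-⊑ {t} (left {m} {n} t⊑m) = begin
  m ⊕ n ⊕ t    ≈⟨ ⊕-assoc m n t ⟨
  m ⊕ (n ⊕ t)  ≈⟨ sum refl (⊕-comm n t) ⟩
  m ⊕ (t ⊕ n)  ≈⟨ ⊕-assoc m t n ⟩
  m ⊕ t ⊕ n    ≈⟨ sum (⊕-absorbs-⊑ t⊑m) refl ⟩
  m ⊕ n        ∎
⊕-absorbs-⊑ {t} (right {m} {n} t⊑n) = begin
  m ⊕ n ⊕ t    ≈⟨ ⊕-assoc m n t ⟨
  m ⊕ (n ⊕ t)  ≈⟨ sum refl (⊕-absorbs-⊑ t⊑n) ⟩
  m ⊕ n        ∎

data Atom : M → Set where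
  yes : Atom (verd yes)
  no  : Atom (verd no)
  var : ∀ x → Atom (var x)

_⊆ᵃ_ : M → M → Set
n ⊆ᵃ m = ∀ {t} → Atom t → t ⊑ n → t ⊑ m

⊕-absorbs-⊆ᵃ : ∀ m n → n ⊆ᵃ m → m ⊕ n ≈ m
⊕-absorbs-⊆ᵃ m (verd end) _ = ⊕-identityʳ m
⊕-absorbs-⊆ᵃ m (verd yes) n⊆m = ⊕-absorbs-⊑ (n⊆m yes here)
⊕-absorbs-⊆ᵃ m (verd no) n⊆m = ⊕-absorbs-⊑ (n⊆m no here)
⊕-absorbs-⊆ᵃ m (var x) n⊆m = ⊕-absorbs-⊑ (n⊆m (var x) here)
⊕-absorbs-⊆ᵃ m (b ∙ n) n⊆m = begin
  m ⊕ b ∙ n  ≈⟨ sum refl (∙-erase b n) ⟩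
  m ⊕ n      ≈⟨ ⊕-absorbs-⊆ᵃ m n (λ at → n⊆m at ∘ pre b) ⟩
  m          ∎
⊕-absorbs-⊆ᵃ m (n₁ ⊕ n₂) n⊆m = begin
  m ⊕ (n₁ ⊕ n₂)  ≈⟨ ⊕-assoc m n₁ n₂ ⟩
  m ⊕ n₁ ⊕ n₂    ≈⟨ sum (⊕-absorbs-⊆ᵃ m n₁ (λ at → n⊆m at ∘ left)) refl ⟩
  m ⊕ n₂         ≈⟨ ⊕-absorbs-⊆ᵃ m n₂ (λ at → n⊆m at ∘ right) ⟩
  m              ∎

⊕-absorbs-yes-no : ∀ {m} n → verd yes ⊑ m → verd no ⊑ m → m ⊕ n ≈ m
⊕-absorbs-yes-no {m} n yes⊑m no⊑m = begin
  m ⊕ n             ≈⟨ sum m-absorbs-yes⊕no refl ⟨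
  m ⊕ yes⊕no ⊕ n    ≈⟨ ⊕-assoc m yes⊕no n ⟨
  m ⊕ (yes⊕no ⊕ n)  ≈⟨ sum refl (yes⊕no-zeroˡ n) ⟩
  m ⊕ yes⊕no        ≈⟨ m-absorbs-yes⊕no ⟩
  m                 ∎
  where
  yes⊕no : M
  yes⊕no = verd yes ⊕ verd no
  m-absorbs-yes⊕no : m ⊕ yes⊕no ≈ m
  m-absorbs-yes⊕no = ⊕-absorbs-⊆ᵃ m yes⊕no λ { yes (left here) → yes⊑m ; no (right here) → no⊑m }

Absorbs : M → M → Set
Absorbs m n = (verd yes ⊑ m × verd no ⊑ m) ⊎ n ⊆ᵃ m

⊕-absorbs : ∀ m n → Absorbs m n → m ⊕ n ≈ m
⊕-absorbs m n (inj₁ (yes⊑m , no⊑m)) = ⊕-absorbs-yes-no n yes⊑m no⊑m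
⊕-absorbs m n (inj₂ n⊆m) = ⊕-absorbs-⊆ᵃ m n n⊆m

⊑-subst : ∀ {t m} σ → t ⊑ m → t [ σ ] ⊑ m [ σ ]
⊑-subst σ here = here
⊑-subst σ (pre b t⊑m) = pre b (⊑-subst σ t⊑m)
⊑-subst σ (left t⊑m) = left (⊑-subst σ t⊑m)
⊑-subst σ (right t⊑m) = right (⊑-subst σ t⊑m)

⊑-subst⁻¹ : ∀ {v} m σ → verd v ⊑ m [ σ ] →
            verd v ⊑ m ⊎ Σ Var λ x → var x ⊑ m × verd v ⊑ σ x
⊑-subst⁻¹ (verd w) σ v⊑w = inj₁ v⊑w
⊑-subst⁻¹ (var x) σ v⊑σx = inj₂ (x , here , v⊑σx)
⊑-subst⁻¹ (b ∙ m) σ (pre _ p) = Sum.map (pre b) (map₂ (map₁ (pre b))) (⊑-subst⁻¹ m σ p)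
⊑-subst⁻¹ (m ⊕ n) σ (left p) = Sum.map left (map₂ (map₁ left)) (⊑-subst⁻¹ m σ p)
⊑-subst⁻¹ (m ⊕ n) σ (right p) = Sum.map right (map₂ (map₁ right)) (⊑-subst⁻¹ n σ p)

Reaches : Verdict → M → Set
Reaches v m = Σ (List ActA) λ s → m ⇒[ s ] verd v

step-⊑ : ∀ {v m m' α} → m ─[ α ]→ m' → verd v ⊑ m' → verd v ⊑ m
step-⊑ (pre b m) p = pre b p
step-⊑ (sumˡ n st) p = left (step-⊑ st p)
step-⊑ (sumʳ n st) p = right (step-⊑ st p)
step-⊑ (verd w α) p = p

⇒ε-⊑ : ∀ {v m m'} → m ⇒ε m' → verd v ⊑ m' → verd v ⊑ m
⇒ε-⊑ ε-refl p = p
⇒ε-⊑ (ε-step st r) p = step-⊑ st (⇒ε-⊑ r p)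

⇒₁-⊑ : ∀ {v m m' b} → m ⇒₁[ b ] m' → verd v ⊑ m' → verd v ⊑ m
⇒₁-⊑ (_ , _ , r₁ , st , r₂) p = ⇒ε-⊑ r₁ (step-⊑ st (⇒ε-⊑ r₂ p))

reaches⇒⊑ : ∀ {v m} → Reaches v m → verd v ⊑ m
reaches⇒⊑ ([] , r) = ⇒ε-⊑ r here
reaches⇒⊑ (b ∷ [] , r) = ⇒₁-⊑ r here
reaches⇒⊑ (b ∷ c ∷ s , _ , r₁ , r) = ⇒₁-⊑ r₁ (reaches⇒⊑ (c ∷ s , r))

∙-⇒ : ∀ {m m' : M} b s → m ⇒[ s ] m' → (b ∙ m) ⇒[ b ∷ s ] m'
∙-⇒ {m} b [] r = b ∙ m , m , ε-refl , pre b m , r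
∙-⇒ {m} b (_ ∷ _) r = m , (b ∙ m , m , ε-refl , pre b m , ε-refl) , r

module _ {m k : M} (simulate : ∀ {α m'} → m ─[ α ]→ m' → k ─[ α ]→ m') where

  -- If m is already the verdict, k reaches it by simulating the verdict's τ self-loop.
  ⇒ε-simulate : ∀ {v} → m ⇒ε verd v → k ⇒ε verd v
  ⇒ε-simulate {v} ε-refl = ε-step (simulate (verd v nothing)) ε-refl
  ⇒ε-simulate (ε-step st r) = ε-step (simulate st) r

  ⇒₁-simulate : ∀ {b m'} → m ⇒₁[ b ] m' → k ⇒₁[ b ] m'
  ⇒₁-simulate (_ , m₂ , ε-refl , st , r) = k , m₂ , ε-refl , simulate st , r
  ⇒₁-simulate (m₁ , m₂ , ε-step st′ r′ , st , r) = m₁ , m₂ , ε-step (simulate st′) r′ , st , r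

  reaches-simulate : ∀ {v} → Reaches v m → Reaches v k
  reaches-simulate ([] , r) = [] , ⇒ε-simulate r
  reaches-simulate (b ∷ [] , r) = b ∷ [] , ⇒₁-simulate r
  reaches-simulate (b ∷ c ∷ s , m₁ , r₁ , r) = b ∷ c ∷ s , m₁ , ⇒₁-simulate r₁ , r

⊑⇒reaches : ∀ {v m} → verd v ⊑ m → Reaches v m
⊑⇒reaches here = [] , ε-refl
⊑⇒reaches (pre b p) = Product.map (b ∷_) (λ {s} → ∙-⇒ b s) (⊑⇒reaches p)
⊑⇒reaches (left {n = n} p) = reaches-simulate (sumˡ n) (⊑⇒reaches p)
⊑⇒reaches (right {m = m} p) = reaches-simulate (sumʳ m) (⊑⇒reaches p)

≼-unary : ∀ s (w : InfWord {ActA}) → s ≼ w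
≼-unary [] w = []≼
≼-unary (_ ∷ s) w = ∷≼ refl (≼-unary s λ i → w (suc i))

aω : InfWord {ActA}
aω _ = a

data Conclusive : Verdict → Set where
  yes : Conclusive yes
  no  : Conclusive no

conclusive-⋢-end : ∀ {v} → Conclusive v → ¬ verd v ⊑ verd end
conclusive-⋢-end yes ()
conclusive-⋢-end no ()

≃ωᶜ⇒reaches : ∀ {m n : M} {v} → m ≃ωᶜ n → Conclusive v → Reaches v m → Reaches v n
≃ωᶜ⇒reaches (≃ₐ , _) yes (s , r) = map₂ proj₁ (Equivalence.to (≃ₐ aω) (s , r , ≼-unary s aω))
≃ωᶜ⇒reaches (_ , ≃ᵣ) no (s , r) = map₂ proj₁ (Equivalence.to (≃ᵣ aω) (s , r , ≼-unary s aω))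

≃ω-sym : {m n : M} → m ≃ω n → n ≃ω m
≃ω-sym m≃n σ closed with m≃n σ closed
... | ≃ₐ , ≃ᵣ = (λ w → ⇔.sym (≃ₐ w)) , (λ w → ⇔.sym (≃ᵣ w))

Covers : M → M → Set
Covers m n = ∀ σ → ClosedSubst σ → ∀ {v} → Conclusive v → verd v ⊑ n [ σ ] → verd v ⊑ m [ σ ]

≃ω⇒covers : {m n : M} → n ≃ω m → Covers m n
≃ω⇒covers n≃m σ closed c = reaches⇒⊑ ∘ ≃ωᶜ⇒reaches (n≃m σ closed) c ∘ ⊑⇒reaches

all-end : Subst {ActA}
all-end _ = verd end

verdict-covered : ∀ {m n v} → Covers m n → Conclusive v → verd v ⊑ n → verd v ⊑ m
verdict-covered {m} cov c v⊑n
  with ⊑-subst⁻¹ m all-end (cov all-end (λ _ → verd end) c (⊑-subst all-end v⊑n))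
... | inj₁ v⊑m = v⊑m
... | inj₂ (_ , _ , v⊑end) = ⊥-elim (conclusive-⋢-end c v⊑end)

point : Var → Verdict → Subst {ActA}
point x v y with x ≟ℕ y
... | Dec.yes _ = verd v
... | Dec.no _ = verd end

point-closed : ∀ x v → ClosedSubst (point x v)
point-closed x v y with x ≟ℕ y
... | Dec.yes _ = verd v
... | Dec.no _ = verd end

point-at : ∀ x v → verd v ⊑ point x v x
point-at x v with x ≟ℕ x
... | Dec.yes _ = here
... | Dec.no x≢x = ⊥-elim (x≢x refl)

point-only : ∀ {x y u v} → Conclusive u → verd u ⊑ point x v y → x ≡ y
point-only {x} {y} c u⊑ with x ≟ℕ y
... | Dec.yes x≡y = x≡y
... | Dec.no _ = ⊥-elim (conclusive-⋢-end c u⊑)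

var-covered : ∀ {m n v x} → Covers m n → Conclusive v → ¬ verd v ⊑ m → var x ⊑ n → var x ⊑ m
var-covered {m} {v = v} {x} cov c v⋢m x⊑n =
  [ ⊥-elim ∘ v⋢m , via-x ]′ (⊑-subst⁻¹ m (point x v) v⊑m[point])
  where
  v⊑m[point] : verd v ⊑ m [ point x v ]
  v⊑m[point] = cov (point x v) (point-closed x v) c
                 (⊑-trans (point-at x v) (⊑-subst (point x v) x⊑n))
  via-x : (Σ Var λ y → var y ⊑ m × verd v ⊑ point x v y) → var x ⊑ m
  via-x (y , y⊑m , v⊑point) with point-only c v⊑point
  ... | refl = y⊑m

atoms-covered : ∀ {m n v} → Covers m n → Conclusive v → ¬ verd v ⊑ m → n ⊆ᵃ m
atoms-covered cov _ _ yes = verdict-covered cov yes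
atoms-covered cov _ _ no = verdict-covered cov no
atoms-covered cov c v⋢m (var x) = var-covered cov c v⋢m

covers⇒absorbs : ∀ {m n} → Covers m n → Absorbs m n
covers⇒absorbs {m} cov with verd-⊑? yes m | verd-⊑? no m
... | Dec.yes yes⊑m | Dec.yes no⊑m = inj₁ (yes⊑m , no⊑m)
... | Dec.no yes⋢m | _ = inj₂ (atoms-covered cov yes yes⋢m)
... | _ | Dec.no no⋢m = inj₂ (atoms-covered cov no no⋢m)

theorem7 : (m n : Mon ActA) → m ≃ω n → E'ω1 ⊢ m ≈ n
theorem7 m n m≃n = begin
  m      ≈⟨ ⊕-absorbs m n m-absorbs-n ⟨
  m ⊕ n  ≈⟨ ⊕-comm m n ⟩
  n ⊕ m  ≈⟨ ⊕-absorbs n m n-absorbs-m ⟩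
  n      ∎
  where
  m-absorbs-n : Absorbs m n
  m-absorbs-n = covers⇒absorbs (≃ω⇒covers {m} {n} (≃ω-sym {m} {n} m≃n))
  n-absorbs-m : Absorbs n m
  n-absorbs-m = covers⇒absorbs (≃ω⇒covers {n} {m} m≃n)
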